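{- Let $p$ be a prime, let $d\neq0$ be a rational number, let $x$ be a $p$-adic integer and let $n$ be a non-negative integer. Then \[ \sum_{k=0}^{n-1}\left(x^2+x-(1+4d)k^2-(1-2d)k\right)\frac{d^{ -k}{x\choose k}{x+k\choose k}}{{2k\choose k}}=\frac{2n(2n-1){x\choose n}{x+n\choose n}}{d^{n-1}{2n\choose n}}, \] \[ \sum_{k=0}^{n-1}\left(x^2+x-(1+4d)k^2-(1+2d)k\right)\frac{d^{ -k}{x\choose k}{x+k\choose k}}{(2k+1){2k\choose k}}=\frac{2n{x\choose n}{x+n\choose n}}{d^{n-1}{2n\choose n}}, \] and \[ \sum_{k=0}^{n-1}\left(x^2+x+2d-(1+4d)k^2-(1+2d)k\right)\frac{d^{ -k}{x\choose k}{x+k\choose k}}{(k+1){2k\choose k}}=2d+\frac{2(2n-1){x\choose n}{x+n\choose n}}{d^{n-1}{2n\choose n}}. \]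
   Context: For $x\in\mathbb{Z}_p$ and $k\in\{0,1,2,\dots\}$, ${x\choose k}=\frac{x(x-1)\cdots(x-k+1)}{k!}$ is the generalized binomial coefficient (so ${x\choose 0}=1$). Empty sums are $0$. The identities are equalities in $\mathbb{Q}_p$. -}

module Defs where

open import Level using (Level)
open import Data.Nat using (ℕ; zero; suc)
open import Data.Integer using (ℤ; +_)
open import Data.Rational using (ℚ; 0ℚ)
import Data.Rational as Q
open import Data.Nat using (_!)
open import Data.Nat.Combinatorics using (_C_)
open import Relation.Binary.PropositionalEquality using (_≢_)
open import Algebra.Bundles using (CommutativeRing)

ℕ→ℚ : ℕ → ℚ
ℕ→ℚ k = (+ k) Q./ 1

-- reciprocal of a natural number (only ever applied to positive numbers,
-- namely k! and (2k choose k), (2k+1), (k+1); the value at 0 is irrelevant)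
invℕ : ℕ → ℚ
invℕ zero    = 0ℚ
invℕ (suc m) = (+ 1) Q./ (suc m)

powℚ : ℚ → ℕ → ℚ
powℚ q zero    = Q.1ℚ
powℚ q (suc k) = powℚ q k Q.* q

dpow⁻ : (d : ℚ) → d ≢ 0ℚ → ℕ → ℚ
dpow⁻ d d≢0 k = powℚ (Q.1/_ d {{Q.≢-nonZero d≢0}}) k

-- Working in a commutative ring R together with a map ι : ℚ → R
-- (in the statement ι is required to be a ring homomorphism, i.e. R is a ℚ-algebra;
-- ℚ_p with ι the inclusion is the case of the paper).
module QAlg {c ℓ : Level} (R : CommutativeRing c ℓ)
            (ι : ℚ → CommutativeRing.Carrier R) where
  open CommutativeRing R

  sumR : ℕ → (ℕ → Carrier) → Carrier
  sumR zero    f = 0#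
  sumR (suc n) f = sumR n f + f n

  fall : Carrier → ℕ → Carrier
  fall x zero    = 1#
  fall x (suc k) = fall x k * (x - ι (ℕ→ℚ k))

  binom : Carrier → ℕ → Carrier
  binom x k = fall x k * ι (invℕ (k !))

{-# OPTIONS --safe #-}
module Submission where

open import Defs
open import Level using (Level)
open import Data.Nat using (ℕ; zero; suc; _!; NonZero)
import Data.Nat as N
import Data.Nat.Properties as NP
open import Data.Nat.Combinatorics using (_C_; nCk≡n!/k![n-k]!; k![n∸k]!∣n!)
open import Data.Nat.DivMod using (m/n*n≡m)
import Data.Integer as Z
import Data.Integer.Properties as ZP
open import Data.Rational using (ℚ; 0ℚ; 1ℚ; fromℚᵘ)
import Data.Rational as Q
import Data.Rational.Properties as QP
open import Data.Rational.Unnormalised using (mkℚᵘ; *≡*)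
import Data.Rational.Unnormalised as Qᵘ
import Data.Rational.Unnormalised.Properties as QᵘP
open import Data.Product using (_×_; _,_)
open import Data.Maybe using (Maybe; just; nothing)
open import Relation.Nullary using (yes; no)
open import Relation.Binary.PropositionalEquality as ≡ using (_≡_; _≢_; module ≡-Reasoning)
open import Algebra.Bundles using (CommutativeRing)
open import Algebra.Morphism.Structures using (IsRingHomomorphism)
import Algebra.Solver.Ring
open import Algebra.Solver.Ring.AlmostCommutativeRing using (_-Raw-AlmostCommutative⟶_; fromCommutativeRing)

-- With b k = (x choose k) (x+k choose k) and weight k = d^{-k} / (2k choose k) one has
--   b (k+1) · (k+1)² = b k · (x-k)(x+k+1)   and   weight (k+1) · 2(2k+1) d = weight k · (k+1).
-- Hence each identity telescopes: if Φ n is the coefficient of b n on its right-hand side and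
-- w k the coefficient of b k in its summand, then Φ (k+1) = w k · (k+1)², and the summand's
-- polynomial in x is (x-k)(x+k+1) - γ k where Φ k = γ k · w k; so the k-th summand equals
-- Φ (k+1) b (k+1) - Φ k b k.

fromℚᵘ-homo-+ : ∀ p q → fromℚᵘ (p Qᵘ.+ q) ≡ fromℚᵘ p Q.+ fromℚᵘ q
fromℚᵘ-homo-+ p q = QP.toℚᵘ-injective (begin
  Q.toℚᵘ (fromℚᵘ (p Qᵘ.+ q))                ≈⟨ QP.toℚᵘ-fromℚᵘ (p Qᵘ.+ q) ⟩
  p Qᵘ.+ q                                   ≈⟨ QᵘP.+-cong (QP.toℚᵘ-fromℚᵘ p) (QP.toℚᵘ-fromℚᵘ q) ⟨
  Q.toℚᵘ (fromℚᵘ p) Qᵘ.+ Q.toℚᵘ (fromℚᵘ q) ≈⟨ QP.toℚᵘ-homo-+ (fromℚᵘ p) (fromℚᵘ q) ⟨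
  Q.toℚᵘ (fromℚᵘ p Q.+ fromℚᵘ q)            ∎)
  where open QᵘP.≃-Reasoning

fromℚᵘ-homo-* : ∀ p q → fromℚᵘ (p Qᵘ.* q) ≡ fromℚᵘ p Q.* fromℚᵘ q
fromℚᵘ-homo-* p q = QP.toℚᵘ-injective (begin
  Q.toℚᵘ (fromℚᵘ (p Qᵘ.* q))                ≈⟨ QP.toℚᵘ-fromℚᵘ (p Qᵘ.* q) ⟩
  p Qᵘ.* q                                   ≈⟨ QᵘP.*-cong (QP.toℚᵘ-fromℚᵘ p) (QP.toℚᵘ-fromℚᵘ q) ⟨
  Q.toℚᵘ (fromℚᵘ p) Qᵘ.* Q.toℚᵘ (fromℚᵘ q) ≈⟨ QP.toℚᵘ-homo-* (fromℚᵘ p) (fromℚᵘ q) ⟨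
  Q.toℚᵘ (fromℚᵘ p Q.* fromℚᵘ q)            ∎)
  where open QᵘP.≃-Reasoning

-- ℕ→ℚ n and invℕ (suc m) are definitionally fromℚᵘ (n / 1) and fromℚᵘ (1 / suc m), so their
-- arithmetic reduces to that of unnormalised rationals.
ℕ→ℚ-homo-+ : ∀ m n → ℕ→ℚ (m N.+ n) ≡ ℕ→ℚ m Q.+ ℕ→ℚ n
ℕ→ℚ-homo-+ m n = ≡.trans
  (≡.cong (λ i → fromℚᵘ (mkℚᵘ i 0))
          (≡.sym (≡.cong₂ Z._+_ (ZP.*-identityʳ (Z.+ m)) (ZP.*-identityʳ (Z.+ n)))))
  (fromℚᵘ-homo-+ (mkℚᵘ (Z.+ m) 0) (mkℚᵘ (Z.+ n) 0))

ℕ→ℚ-homo-* : ∀ m n → ℕ→ℚ (m N.* n) ≡ ℕ→ℚ m Q.* ℕ→ℚ n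
ℕ→ℚ-homo-* m n = ≡.trans (≡.cong (λ i → fromℚᵘ (mkℚᵘ i 0)) (ZP.pos-* m n))
  (fromℚᵘ-homo-* (mkℚᵘ (Z.+ m) 0) (mkℚᵘ (Z.+ n) 0))

ℕ→ℚ-suc : ∀ n → ℕ→ℚ (suc n) ≡ 1ℚ Q.+ ℕ→ℚ n
ℕ→ℚ-suc = ℕ→ℚ-homo-+ 1

invℕ-cross : ∀ {a b m n} .{{_ : NonZero a}} .{{_ : NonZero b}} →
             a N.* m ≡ b N.* n → invℕ b Q.* ℕ→ℚ m ≡ invℕ a Q.* ℕ→ℚ n
invℕ-cross {suc a} {suc b} {m} {n} am≡bn = begin
  invℕ (suc b) Q.* ℕ→ℚ m      ≡⟨ fromℚᵘ-homo-* (mkℚᵘ (Z.+ 1) b) (mkℚᵘ (Z.+ m) 0) ⟨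
  fromℚᵘ m/b                   ≡⟨ QP.fromℚᵘ-cong {m/b} {n/a} (*≡* cross) ⟩
  fromℚᵘ n/a                   ≡⟨ fromℚᵘ-homo-* (mkℚᵘ (Z.+ 1) a) (mkℚᵘ (Z.+ n) 0) ⟩
  invℕ (suc a) Q.* ℕ→ℚ n      ∎
  where
  open ≡-Reasoning
  m/b = mkℚᵘ (Z.+ 1) b Qᵘ.* mkℚᵘ (Z.+ m) 0
  n/a = mkℚᵘ (Z.+ 1) a Qᵘ.* mkℚᵘ (Z.+ n) 0
  normal : ∀ c j → (Z.+ 1 Z.* Z.+ j) Z.* Z.+ (c N.* 1) ≡ Z.+ (c N.* j)
  normal c j = begin
    (Z.+ 1 Z.* Z.+ j) Z.* Z.+ (c N.* 1)
      ≡⟨ ≡.cong₂ Z._*_ (ZP.*-identityˡ (Z.+ j)) (≡.cong Z.+_ (NP.*-identityʳ c)) ⟩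
    Z.+ j Z.* Z.+ c                     ≡⟨ ZP.pos-* j c ⟨
    Z.+ (j N.* c)                       ≡⟨ ≡.cong Z.+_ (NP.*-comm j c) ⟩
    Z.+ (c N.* j)                       ∎
  cross : (Z.+ 1 Z.* Z.+ m) Z.* Z.+ (suc a N.* 1) ≡ (Z.+ 1 Z.* Z.+ n) Z.* Z.+ (suc b N.* 1)
  cross = ≡.trans (normal (suc a) m) (≡.trans (≡.cong Z.+_ am≡bn) (≡.sym (normal (suc b) n)))

invℕ-inverseˡ : ∀ n .{{_ : NonZero n}} → invℕ n Q.* ℕ→ℚ n ≡ 1ℚ
invℕ-inverseˡ n = invℕ-cross {1} {n} (NP.*-comm 1 n)

invℕ-!-suc : ∀ k → invℕ (suc k !) Q.* ℕ→ℚ (suc k) ≡ invℕ (k !)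
invℕ-!-suc k =
  ≡.trans (invℕ-cross {k !} {suc k !} {suc k} {1} {{k NP.!≢0}} {{suc k NP.!≢0}} k!*[1+k]≡[1+k]!*1)
          (QP.*-identityʳ (invℕ (k !)))
  where
  k!*[1+k]≡[1+k]!*1 : k ! N.* suc k ≡ suc k ! N.* 1
  k!*[1+k]≡[1+k]!*1 = ≡.trans (NP.*-comm (k !) (suc k)) (≡.sym (NP.*-identityʳ (suc k !)))

centralBinomial : ℕ → ℕ
centralBinomial k = (2 N.* k) C k

centralBinomial-*-k!² : ∀ k → centralBinomial k N.* (k ! N.* k !) ≡ (2 N.* k) !
centralBinomial-*-k!² k = begin
  centralBinomial k N.* (k ! N.* k !)       ≡⟨ ≡.cong (λ j → centralBinomial k N.* (k ! N.* j !)) 2k∸k≡k ⟨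
  centralBinomial k N.* k![2k∸k]!           ≡⟨ ≡.cong (N._* k![2k∸k]!) (nCk≡n!/k![n-k]! k≤2k) ⟩
  (2 N.* k) ! N./ k![2k∸k]! N.* k![2k∸k]!   ≡⟨ m/n*n≡m (k![n∸k]!∣n! k≤2k) ⟩
  (2 N.* k) !                               ∎
  where
  open ≡-Reasoning
  k![2k∸k]! = k ! N.* (2 N.* k N.∸ k) !
  instance _ = k NP.!* (2 N.* k N.∸ k) !≢0
  k≤2k : k N.≤ 2 N.* k
  k≤2k = NP.m≤m+n k (k N.+ 0)
  2k∸k≡k : 2 N.* k N.∸ k ≡ k
  2k∸k≡k = ≡.trans (NP.m+n∸m≡n k (k N.+ 0)) (NP.+-identityʳ k)

centralBinomial-nonZero : ∀ k → NonZero (centralBinomial k)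
centralBinomial-nonZero k = NP.m*n≢0⇒m≢0 (centralBinomial k)
  {{≡.subst NonZero (≡.sym (centralBinomial-*-k!² k)) ((2 N.* k) NP.!≢0)}}

-- After multiplying by k! (k+1)!, both sides equal (2k+2)!.
centralBinomial-suc : ∀ k → centralBinomial (suc k) N.* suc k ≡ 2 N.* suc (2 N.* k) N.* centralBinomial k
centralBinomial-suc k = NP.*-cancelʳ-≡ _ _ (k ! N.* suc k !) {{k NP.!* suc k !≢0}} (begin
  c′ N.* suc k N.* (k ! N.* suc k !)
    ≡⟨ solve 3 (λ c′ k f → c′ :* (con 1 :+ k) :* (f :* ((con 1 :+ k) :* f))
                        := c′ :* ((con 1 :+ k) :* f :* ((con 1 :+ k) :* f))) ≡.refl c′ k (k !) ⟩
  c′ N.* (suc k ! N.* suc k !)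
    ≡⟨ centralBinomial-*-k!² (suc k) ⟩
  (2 N.* suc k) !
    ≡⟨ ≡.cong _! (NP.*-suc 2 k) ⟩
  (2 N.+ 2 N.* k) N.* (suc (2 N.* k) N.* (2 N.* k) !)
    ≡⟨ ≡.cong (λ j → (2 N.+ 2 N.* k) N.* (suc (2 N.* k) N.* j)) (centralBinomial-*-k!² k) ⟨
  (2 N.+ 2 N.* k) N.* (suc (2 N.* k) N.* (c N.* (k ! N.* k !)))
    ≡⟨ solve 3 (λ c k f → (con 2 :+ con 2 :* k) :* ((con 1 :+ con 2 :* k) :* (c :* (f :* f)))
                       := con 2 :* (con 1 :+ con 2 :* k) :* c :* (f :* ((con 1 :+ k) :* f))) ≡.refl c k (k !) ⟩
  2 N.* suc (2 N.* k) N.* c N.* (k ! N.* suc k !) ∎)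
  where
  open ≡-Reasoning
  open import Data.Nat.Solver using (module +-*-Solver)
  open +-*-Solver
  c′ = centralBinomial (suc k)
  c = centralBinomial k

invℕ-centralBinomial-suc : ∀ k → invℕ (centralBinomial k) Q.* ℕ→ℚ (suc k)
                               ≡ invℕ (centralBinomial (suc k)) Q.* ℕ→ℚ (2 N.* suc (2 N.* k))
invℕ-centralBinomial-suc k =
  invℕ-cross {{centralBinomial-nonZero (suc k)}} {{centralBinomial-nonZero k}}
             (≡.trans (centralBinomial-suc k) (NP.*-comm (2 N.* suc (2 N.* k)) (centralBinomial k)))

module Certificates (d : ℚ) (d≢0 : d ≢ 0ℚ) where
  open import Data.Rational using (_+_; _*_; _-_; -_)
  open import Data.Rational.Solver using (module +-*-Solver)
  open +-*-Solver
  open ≡-Reasoning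

  two : ℚ
  two = ℕ→ℚ 2

  ℕ→ℚ-2*-suc : ∀ k → ℕ→ℚ (2 N.* suc k) ≡ two * (1ℚ + ℕ→ℚ k)
  ℕ→ℚ-2*-suc k = ≡.trans (ℕ→ℚ-homo-* 2 (suc k)) (≡.cong (two *_) (ℕ→ℚ-suc k))

  ℕ→ℚ-suc-2* : ∀ k → ℕ→ℚ (suc (2 N.* k)) ≡ 1ℚ + two * ℕ→ℚ k
  ℕ→ℚ-suc-2* k = ≡.trans (ℕ→ℚ-suc (2 N.* k)) (≡.cong (1ℚ +_) (ℕ→ℚ-homo-* 2 k))

  invℕ-suc-inverse : ∀ k → invℕ (suc k) * (1ℚ + ℕ→ℚ k) ≡ 1ℚ
  invℕ-suc-inverse k = ≡.trans (≡.cong (invℕ (suc k) *_) (≡.sym (ℕ→ℚ-suc k))) (invℕ-inverseˡ (suc k))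

  invℕ-suc-2*-inverse : ∀ k → invℕ (suc (2 N.* k)) * (1ℚ + two * ℕ→ℚ k) ≡ 1ℚ
  invℕ-suc-2*-inverse k = ≡.trans (≡.cong (invℕ (suc (2 N.* k)) *_) (≡.sym (ℕ→ℚ-suc-2* k)))
                                  (invℕ-inverseˡ (suc (2 N.* k)))

  x≡x*[a⁻¹*a] : ∀ x {a a⁻¹} → a⁻¹ * a ≡ 1ℚ → x ≡ x * (a⁻¹ * a)
  x≡x*[a⁻¹*a] x a⁻¹*a≡1 = ≡.sym (≡.trans (≡.cong (x *_) a⁻¹*a≡1) (QP.*-identityʳ x))

  d⁻¹ : ℚ
  d⁻¹ = Q.1/_ d {{Q.≢-nonZero d≢0}}

  D : ℕ → ℚ
  D = dpow⁻ d d≢0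

  weight : ℕ → ℚ
  weight k = D k * invℕ (centralBinomial k)

  weight-suc : ∀ k → weight (suc k) * d * (two * (1ℚ + two * ℕ→ℚ k)) ≡ weight k * (1ℚ + ℕ→ℚ k)
  weight-suc k = begin
    D k * d⁻¹ * c′ * d * (two * (1ℚ + two * ℕ→ℚ k))
      ≡⟨ ≡.cong (D k * d⁻¹ * c′ * d *_)
                (≡.trans (ℕ→ℚ-homo-* 2 (suc (2 N.* k))) (≡.cong (two *_) (ℕ→ℚ-suc-2* k))) ⟨
    D k * d⁻¹ * c′ * d * ℕ→ℚ (2 N.* suc (2 N.* k))
      ≡⟨ solve 5 (λ D e c′ d t → D :* e :* c′ :* d :* t := D :* (d :* e) :* (c′ :* t))
                 ≡.refl (D k) d⁻¹ c′ d (ℕ→ℚ (2 N.* suc (2 N.* k))) ⟩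
    D k * (d * d⁻¹) * (c′ * ℕ→ℚ (2 N.* suc (2 N.* k)))
      ≡⟨ ≡.cong₂ (λ s t → D k * s * t) (QP.*-inverseʳ d {{Q.≢-nonZero d≢0}})
                                         (≡.sym (invℕ-centralBinomial-suc k)) ⟩
    D k * 1ℚ * (c * ℕ→ℚ (suc k))
      ≡⟨ ≡.cong (λ t → D k * 1ℚ * (c * t)) (ℕ→ℚ-suc k) ⟩
    D k * 1ℚ * (c * (1ℚ + ℕ→ℚ k))
      ≡⟨ solve 3 (λ D c K → D :* con 1ℚ :* (c :* K) := D :* c :* K) ≡.refl (D k) c (1ℚ + ℕ→ℚ k) ⟩
    D k * c * (1ℚ + ℕ→ℚ k) ∎
    where
    c = invℕ (centralBinomial k)
    c′ = invℕ (centralBinomial (suc k))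

  weight-suc-scaled : ∀ k i → (1ℚ + ℕ→ℚ k) * i * (weight (suc k) * d * (two * (1ℚ + two * ℕ→ℚ k)))
                              ≡ weight k * i * (ℕ→ℚ (suc k) * ℕ→ℚ (suc k))
  weight-suc-scaled k i = begin
    (1ℚ + K) * i * (weight (suc k) * d * (two * (1ℚ + two * K)))
      ≡⟨ ≡.cong ((1ℚ + K) * i *_) (weight-suc k) ⟩
    (1ℚ + K) * i * (weight k * (1ℚ + K))
      ≡⟨ solve 3 (λ K i u → (con 1ℚ :+ K) :* i :* (u :* (con 1ℚ :+ K))
                         := u :* i :* ((con 1ℚ :+ K) :* (con 1ℚ :+ K))) ≡.refl K i (weight k) ⟩
    weight k * i * ((1ℚ + K) * (1ℚ + K))
      ≡⟨ ≡.cong (λ t → weight k * i * (t * t)) (ℕ→ℚ-suc k) ⟨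
    weight k * i * (ℕ→ℚ (suc k) * ℕ→ℚ (suc k)) ∎
    where K = ℕ→ℚ k

  Φ₁ Φ₂ Φ₃ γ₁ γ₂ γ₃ : ℕ → ℚ
  Φ₁ n = ℕ→ℚ (2 N.* n) * (ℕ→ℚ (2 N.* n) - 1ℚ) * d * D n * invℕ (centralBinomial n)
  Φ₂ n = ℕ→ℚ (2 N.* n) * d * D n * invℕ (centralBinomial n)
  Φ₃ n = two * (ℕ→ℚ (2 N.* n) - 1ℚ) * d * D n * invℕ (centralBinomial n)
  γ₁ k = two * ℕ→ℚ k * (two * ℕ→ℚ k - 1ℚ) * d
  γ₂ k = two * ℕ→ℚ k * d * (1ℚ + two * ℕ→ℚ k)
  γ₃ k = two * (two * ℕ→ℚ k - 1ℚ) * d * (1ℚ + ℕ→ℚ k)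

  Φ₁≡γ₁*weight : ∀ k → Φ₁ k ≡ γ₁ k * weight k
  Φ₁≡γ₁*weight k = ≡.trans (≡.cong (λ t → t * (t - 1ℚ) * d * D k * c) (ℕ→ℚ-homo-* 2 k))
    (solve 4 (λ K d D c → con two :* K :* (con two :* K :- con 1ℚ) :* d :* D :* c
                        := con two :* K :* (con two :* K :- con 1ℚ) :* d :* (D :* c)) ≡.refl (ℕ→ℚ k) d (D k) c)
    where c = invℕ (centralBinomial k)

  Φ₂≡γ₂*weight : ∀ k → Φ₂ k ≡ γ₂ k * (weight k * invℕ (suc (2 N.* k)))
  Φ₂≡γ₂*weight k = begin
    ℕ→ℚ (2 N.* k) * d * D k * c
      ≡⟨ ≡.cong (λ t → t * d * D k * c) (ℕ→ℚ-homo-* 2 k) ⟩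
    two * K * d * D k * c
      ≡⟨ x≡x*[a⁻¹*a] (two * K * d * D k * c) {1ℚ + two * K} {i} (invℕ-suc-2*-inverse k) ⟩
    two * K * d * D k * c * (i * (1ℚ + two * K))
      ≡⟨ solve 5 (λ K d D c i → con two :* K :* d :* D :* c :* (i :* (con 1ℚ :+ con two :* K))
                             := con two :* K :* d :* (con 1ℚ :+ con two :* K) :* (D :* c :* i))
                 ≡.refl K d (D k) c i ⟩
    γ₂ k * (weight k * i) ∎
    where
    K = ℕ→ℚ k
    c = invℕ (centralBinomial k)
    i = invℕ (suc (2 N.* k))

  Φ₃≡γ₃*weight : ∀ k → Φ₃ k ≡ γ₃ k * (weight k * invℕ (suc k))
  Φ₃≡γ₃*weight k = begin
    two * (ℕ→ℚ (2 N.* k) - 1ℚ) * d * D k * c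
      ≡⟨ ≡.cong (λ t → two * (t - 1ℚ) * d * D k * c) (ℕ→ℚ-homo-* 2 k) ⟩
    two * (two * K - 1ℚ) * d * D k * c
      ≡⟨ x≡x*[a⁻¹*a] (two * (two * K - 1ℚ) * d * D k * c) {1ℚ + K} {i} (invℕ-suc-inverse k) ⟩
    two * (two * K - 1ℚ) * d * D k * c * (i * (1ℚ + K))
      ≡⟨ solve 5 (λ K d D c i → con two :* (con two :* K :- con 1ℚ) :* d :* D :* c :* (i :* (con 1ℚ :+ K))
                             := con two :* (con two :* K :- con 1ℚ) :* d :* (con 1ℚ :+ K) :* (D :* c :* i))
                 ≡.refl K d (D k) c i ⟩
    γ₃ k * (weight k * i) ∎
    where
    K = ℕ→ℚ k
    c = invℕ (centralBinomial k)
    i = invℕ (suc k)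

  Φ₁-suc : ∀ k → Φ₁ (suc k) ≡ weight k * (ℕ→ℚ (suc k) * ℕ→ℚ (suc k))
  Φ₁-suc k = begin
    ℕ→ℚ (2 N.* suc k) * (ℕ→ℚ (2 N.* suc k) - 1ℚ) * d * D′ * c′
      ≡⟨ ≡.cong (λ t → t * (t - 1ℚ) * d * D′ * c′) (ℕ→ℚ-2*-suc k) ⟩
    two * (1ℚ + K) * (two * (1ℚ + K) - 1ℚ) * d * D′ * c′
      ≡⟨ solve 4 (λ K d D′ c′ → con two :* (con 1ℚ :+ K) :* (con two :* (con 1ℚ :+ K) :- con 1ℚ)
                                 :* d :* D′ :* c′
                             := (con 1ℚ :+ K) :* con 1ℚ :* (D′ :* c′ :* d :* (con two :* (con 1ℚ :+ con two :* K))))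
                 ≡.refl K d D′ c′ ⟩
    (1ℚ + K) * 1ℚ * (weight (suc k) * d * (two * (1ℚ + two * K)))
      ≡⟨ weight-suc-scaled k 1ℚ ⟩
    weight k * 1ℚ * (ℕ→ℚ (suc k) * ℕ→ℚ (suc k))
      ≡⟨ ≡.cong (_* (ℕ→ℚ (suc k) * ℕ→ℚ (suc k))) (QP.*-identityʳ (weight k)) ⟩
    weight k * (ℕ→ℚ (suc k) * ℕ→ℚ (suc k)) ∎
    where
    K = ℕ→ℚ k
    D′ = D (suc k)
    c′ = invℕ (centralBinomial (suc k))

  Φ₂-suc : ∀ k → Φ₂ (suc k) ≡ weight k * invℕ (suc (2 N.* k)) * (ℕ→ℚ (suc k) * ℕ→ℚ (suc k))
  Φ₂-suc k = begin
    ℕ→ℚ (2 N.* suc k) * d * D′ * c′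
      ≡⟨ ≡.cong (λ t → t * d * D′ * c′) (ℕ→ℚ-2*-suc k) ⟩
    two * (1ℚ + K) * d * D′ * c′
      ≡⟨ x≡x*[a⁻¹*a] (two * (1ℚ + K) * d * D′ * c′) {1ℚ + two * K} {i} (invℕ-suc-2*-inverse k) ⟩
    two * (1ℚ + K) * d * D′ * c′ * (i * (1ℚ + two * K))
      ≡⟨ solve 5 (λ K d D′ c′ i → con two :* (con 1ℚ :+ K) :* d :* D′ :* c′
                                   :* (i :* (con 1ℚ :+ con two :* K))
                               := (con 1ℚ :+ K) :* i :* (D′ :* c′ :* d :* (con two :* (con 1ℚ :+ con two :* K))))
                 ≡.refl K d D′ c′ i ⟩
    (1ℚ + K) * i * (weight (suc k) * d * (two * (1ℚ + two * K)))
      ≡⟨ weight-suc-scaled k i ⟩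
    weight k * i * (ℕ→ℚ (suc k) * ℕ→ℚ (suc k)) ∎
    where
    K = ℕ→ℚ k
    D′ = D (suc k)
    c′ = invℕ (centralBinomial (suc k))
    i = invℕ (suc (2 N.* k))

  Φ₃-suc : ∀ k → Φ₃ (suc k) ≡ weight k * invℕ (suc k) * (ℕ→ℚ (suc k) * ℕ→ℚ (suc k))
  Φ₃-suc k = begin
    two * (ℕ→ℚ (2 N.* suc k) - 1ℚ) * d * D′ * c′
      ≡⟨ ≡.cong (λ t → two * (t - 1ℚ) * d * D′ * c′) (ℕ→ℚ-2*-suc k) ⟩
    two * (two * (1ℚ + K) - 1ℚ) * d * D′ * c′
      ≡⟨ x≡x*[a⁻¹*a] (two * (two * (1ℚ + K) - 1ℚ) * d * D′ * c′) {1ℚ + K} {i} (invℕ-suc-inverse k) ⟩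
    two * (two * (1ℚ + K) - 1ℚ) * d * D′ * c′ * (i * (1ℚ + K))
      ≡⟨ solve 5 (λ K d D′ c′ i → con two :* (con two :* (con 1ℚ :+ K) :- con 1ℚ) :* d :* D′ :* c′
                                   :* (i :* (con 1ℚ :+ K))
                               := (con 1ℚ :+ K) :* i :* (D′ :* c′ :* d :* (con two :* (con 1ℚ :+ con two :* K))))
                 ≡.refl K d D′ c′ i ⟩
    (1ℚ + K) * i * (weight (suc k) * d * (two * (1ℚ + two * K)))
      ≡⟨ weight-suc-scaled k i ⟩
    weight k * i * (ℕ→ℚ (suc k) * ℕ→ℚ (suc k)) ∎
    where
    K = ℕ→ℚ k
    D′ = D (suc k)
    c′ = invℕ (centralBinomial (suc k))
    i = invℕ (suc k)

  Φ₁-zero : Φ₁ 0 ≡ 0ℚ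
  Φ₁-zero = solve 1 (λ d → con 0ℚ :* (con 0ℚ :- con 1ℚ) :* d :* con 1ℚ :* con 1ℚ := con 0ℚ) ≡.refl d

  Φ₂-zero : Φ₂ 0 ≡ 0ℚ
  Φ₂-zero = solve 1 (λ d → con 0ℚ :* d :* con 1ℚ :* con 1ℚ := con 0ℚ) ≡.refl d

  Φ₃-zero : Φ₃ 0 ≡ - (two * d)
  Φ₃-zero = solve 1 (λ d → con two :* (con 0ℚ :- con 1ℚ) :* d :* con 1ℚ :* con 1ℚ := :- (con two :* d)) ≡.refl d

  γ₁-splits : ∀ k → 0ℚ - (1ℚ + ℕ→ℚ 4 * d) * ℕ→ℚ k * ℕ→ℚ k - (1ℚ - two * d) * ℕ→ℚ k + γ₁ k
                    ≡ - (ℕ→ℚ k * ℕ→ℚ k) - ℕ→ℚ k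
  γ₁-splits k = solve 2 (λ K d → con 0ℚ :- (con 1ℚ :+ con (ℕ→ℚ 4) :* d) :* K :* K
                                 :- (con 1ℚ :- con two :* d) :* K
                                 :+ con two :* K :* (con two :* K :- con 1ℚ) :* d
                               := :- (K :* K) :- K) ≡.refl (ℕ→ℚ k) d

  γ₂-splits : ∀ k → 0ℚ - (1ℚ + ℕ→ℚ 4 * d) * ℕ→ℚ k * ℕ→ℚ k - (1ℚ + two * d) * ℕ→ℚ k + γ₂ k
                    ≡ - (ℕ→ℚ k * ℕ→ℚ k) - ℕ→ℚ k
  γ₂-splits k = solve 2 (λ K d → con 0ℚ :- (con 1ℚ :+ con (ℕ→ℚ 4) :* d) :* K :* K
                                 :- (con 1ℚ :+ con two :* d) :* K
                                 :+ con two :* K :* d :* (con 1ℚ :+ con two :* K)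
                               := :- (K :* K) :- K) ≡.refl (ℕ→ℚ k) d

  γ₃-splits : ∀ k → two * d - (1ℚ + ℕ→ℚ 4 * d) * ℕ→ℚ k * ℕ→ℚ k - (1ℚ + two * d) * ℕ→ℚ k + γ₃ k
                    ≡ - (ℕ→ℚ k * ℕ→ℚ k) - ℕ→ℚ k
  γ₃-splits k = solve 2 (λ K d → con two :* d :- (con 1ℚ :+ con (ℕ→ℚ 4) :* d) :* K :* K
                                 :- (con 1ℚ :+ con two :* d) :* K
                                 :+ con two :* (con two :* K :- con 1ℚ) :* d :* (con 1ℚ :+ K)
                               := :- (K :* K) :- K) ≡.refl (ℕ→ℚ k) d

module ℚ-Algebra {c ℓ} (R : CommutativeRing c ℓ) (ι : ℚ → CommutativeRing.Carrier R)
                 (ι-isRingHomomorphism : IsRingHomomorphism QP.+-*-rawRing (CommutativeRing.rawRing R) ι) where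
  open CommutativeRing R
  open QAlg R ι
  open IsRingHomomorphism ι-isRingHomomorphism
  open import Relation.Binary.Reasoning.Setoid setoid

  private
    ι-morphism : QP.+-*-rawRing -Raw-AlmostCommutative⟶ fromCommutativeRing R
    ι-morphism = record { ⟦_⟧ = ι ; +-homo = +-homo ; *-homo = *-homo ; -‿homo = -‿homo
                        ; 0-homo = 0#-homo ; 1-homo = 1#-homo }

    ι-≟ : ∀ p q → Maybe (ι p ≈ ι q)
    ι-≟ p q with p QP.≟ q
    ... | yes p≡q = just (⟦⟧-cong p≡q)
    ... | no _    = nothing

  open Algebra.Solver.Ring QP.+-*-rawRing (fromCommutativeRing R) ι-morphism ι-≟

  ι-ℕ→ℚ-suc : ∀ k → ι (ℕ→ℚ (suc k)) ≈ 1# + ι (ℕ→ℚ k)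
  ι-ℕ→ℚ-suc k = trans (⟦⟧-cong (ℕ→ℚ-suc k)) (trans (+-homo 1ℚ (ℕ→ℚ k)) (+-cong 1#-homo refl))

  sumR-telescope : ∀ (f F : ℕ → Carrier) → (∀ k → F (suc k) ≈ F k + f k) → ∀ n → sumR n f ≈ F n - F 0
  sumR-telescope f F F-suc zero    = sym (-‿inverseʳ (F 0))
  sumR-telescope f F F-suc (suc n) = begin
    sumR n f + f n        ≈⟨ +-cong (sumR-telescope f F F-suc n) refl ⟩
    F n - F 0 + f n       ≈⟨ solve 3 (λ a b c → a :- b :+ c := a :+ c :- b) refl (F n) (F 0) (f n) ⟩
    F n + f n - F 0       ≈⟨ +-cong (sym (F-suc n)) refl ⟩
    F (suc n) - F 0       ∎

  fall-cong : ∀ {y z} k → y ≈ z → fall y k ≈ fall z k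
  fall-cong zero    y≈z = refl
  fall-cong (suc k) y≈z = *-cong (fall-cong k y≈z) (+-cong y≈z refl)

  binom-cong : ∀ {y z} k → y ≈ z → binom y k ≈ binom z k
  binom-cong k y≈z = *-cong (fall-cong k y≈z) refl

  fall-+1 : ∀ y k → fall (y + 1#) (suc k) ≈ (y + 1#) * fall y k
  fall-+1 y zero    = begin
    1# * (y + 1# - ι 0ℚ)    ≈⟨ solve 2 (λ y o → o :* (y :+ o :- con 0ℚ) := (y :+ o) :* o) refl y 1# ⟩
    (y + 1#) * 1#           ∎
  fall-+1 y (suc k) = begin
    fall (y + 1#) (suc k) * (y + 1# - ι (ℕ→ℚ (suc k)))
      ≈⟨ *-cong (fall-+1 y k) (+-cong refl (-‿cong (ι-ℕ→ℚ-suc k))) ⟩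
    (y + 1#) * fall y k * (y + 1# - (1# + ι (ℕ→ℚ k)))
      ≈⟨ solve 4 (λ y o f t → (y :+ o) :* f :* (y :+ o :- (o :+ t)) := (y :+ o) :* (f :* (y :- t)))
                 refl y 1# (fall y k) (ι (ℕ→ℚ k)) ⟩
    (y + 1#) * (fall y k * (y - ι (ℕ→ℚ k))) ∎

  ι-homo-sub : ∀ p q → ι (p Q.- q) ≈ ι p - ι q
  ι-homo-sub p q = trans (+-homo p (Q.- q)) (+-cong refl (-‿homo q))

  ι-cancel-zero : ∀ y {q} → q ≡ 0ℚ → y - ι q ≈ y
  ι-cancel-zero y q≡0 = trans (+-cong refl (-‿cong (⟦⟧-cong q≡0))) (solve 1 (λ y → y :- con 0ℚ := y) refl y)

  ι-cancel-neg : ∀ y {p q} → q ≡ Q.- p → y - ι q ≈ ι p + y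
  ι-cancel-neg y {p} q≡-p = trans (+-cong refl (-‿cong (trans (⟦⟧-cong q≡-p) (-‿homo p))))
                                  (solve 2 (λ y p → y :- (:- p) := p :+ y) refl y (ι p))

  ι-invℕ-!-suc : ∀ k → ι (invℕ (suc k !)) * ι (ℕ→ℚ (suc k)) ≈ ι (invℕ (k !))
  ι-invℕ-!-suc k = trans (sym (*-homo _ _)) (⟦⟧-cong (invℕ-!-suc k))

  binom-zero : ∀ y → binom y 0 ≈ 1#
  binom-zero y = trans (*-identityˡ _) 1#-homo

  binom-suc : ∀ y k → binom y (suc k) * ι (ℕ→ℚ (suc k)) ≈ binom y k * (y - ι (ℕ→ℚ k))
  binom-suc y k = begin
    fall y k * (y - ι (ℕ→ℚ k)) * ι (invℕ (suc k !)) * ι (ℕ→ℚ (suc k))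
      ≈⟨ *-assoc _ _ _ ⟩
    fall y k * (y - ι (ℕ→ℚ k)) * (ι (invℕ (suc k !)) * ι (ℕ→ℚ (suc k)))
      ≈⟨ *-cong refl (ι-invℕ-!-suc k) ⟩
    fall y k * (y - ι (ℕ→ℚ k)) * ι (invℕ (k !))
      ≈⟨ solve 3 (λ f t i → f :* t :* i := f :* i :* t) refl (fall y k) (y - ι (ℕ→ℚ k)) (ι (invℕ (k !))) ⟩
    binom y k * (y - ι (ℕ→ℚ k)) ∎

  binom-+1 : ∀ y k → binom (y + 1#) (suc k) * ι (ℕ→ℚ (suc k)) ≈ (y + 1#) * binom y k
  binom-+1 y k = begin
    fall (y + 1#) (suc k) * ι (invℕ (suc k !)) * ι (ℕ→ℚ (suc k))
      ≈⟨ trans (*-assoc _ _ _) (*-cong (fall-+1 y k) (ι-invℕ-!-suc k)) ⟩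
    (y + 1#) * fall y k * ι (invℕ (k !))
      ≈⟨ *-assoc _ _ _ ⟩
    (y + 1#) * binom y k ∎

  module _ (x : Carrier) where

    b : ℕ → Carrier
    b k = binom x k * binom (x + ι (ℕ→ℚ k)) k

    P : ℕ → Carrier
    P k = (x - ι (ℕ→ℚ k)) * (x + ι (ℕ→ℚ k) + 1#)

    b-zero : b 0 ≈ 1#
    b-zero = trans (*-cong (binom-zero x) (binom-zero (x + ι 0ℚ))) (*-identityˡ 1#)

    b-suc : ∀ k → b (suc k) * ι (ℕ→ℚ (suc k) Q.* ℕ→ℚ (suc k)) ≈ b k * P k
    b-suc k = begin
      binom x (suc k) * binom (x + ι S) (suc k) * ι (S Q.* S)
        ≈⟨ *-cong (*-cong refl (binom-cong (suc k) shift)) (*-homo S S) ⟩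
      binom x (suc k) * binom (x + ι K + 1#) (suc k) * (ι S * ι S)
        ≈⟨ solve 3 (λ a c s → a :* c :* (s :* s) := (a :* s) :* (c :* s)) refl _ _ (ι S) ⟩
      (binom x (suc k) * ι S) * (binom (x + ι K + 1#) (suc k) * ι S)
        ≈⟨ *-cong (binom-suc x k) (binom-+1 (x + ι K) k) ⟩
      (binom x k * (x - ι K)) * ((x + ι K + 1#) * binom (x + ι K) k)
        ≈⟨ solve 4 (λ a c t u → a :* t :* (u :* c) := a :* c :* (t :* u)) refl _ _ (x - ι K) (x + ι K + 1#) ⟩
      b k * P k ∎
      where
      K = ℕ→ℚ k
      S = ℕ→ℚ (suc k)
      shift : x + ι S ≈ x + ι K + 1#
      shift = trans (+-cong refl (ι-ℕ→ℚ-suc k)) (solve 3 (λ x o t → x :+ (o :+ t) := x :+ t :+ o) refl x 1# (ι K))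

    P-decomposition : ∀ {p q r s : ℕ → ℚ}
                    → (∀ k → p k Q.- q k Q.- r k Q.+ s k ≡ Q.- (ℕ→ℚ k Q.* ℕ→ℚ k) Q.- ℕ→ℚ k)
                    → ∀ k → x * x + x + ι (p k) - ι (q k) - ι (r k) + ι (s k) ≈ P k
    P-decomposition {p} {q} {r} {s} eq k = begin
      x * x + x + ι (p k) - ι (q k) - ι (r k) + ι (s k)
        ≈⟨ solve 5 (λ x p q r s → x :* x :+ x :+ p :- q :- r :+ s := x :* x :+ x :+ (p :- q :- r :+ s))
                   refl x (ι (p k)) (ι (q k)) (ι (r k)) (ι (s k)) ⟩
      x * x + x + (ι (p k) - ι (q k) - ι (r k) + ι (s k))
        ≈⟨ +-cong refl (sym (trans (+-homo _ (s k))
                                   (+-cong (trans (ι-homo-sub _ (r k)) (+-cong (ι-homo-sub (p k) (q k)) refl)) refl))) ⟩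
      x * x + x + ι (p k Q.- q k Q.- r k Q.+ s k)
        ≈⟨ +-cong refl (trans (⟦⟧-cong (eq k)) (trans (ι-homo-sub _ K)
                                                        (+-cong (trans (-‿homo _) (-‿cong (*-homo K K))) refl))) ⟩
      x * x + x + (- (ι K * ι K) - ι K)
        ≈⟨ solve 2 (λ x t → x :* x :+ x :+ (:- (t :* t) :- t) := (x :- t) :* (x :+ t :+ con 1ℚ)) refl x (ι K) ⟩
      (x - ι K) * (x + ι K + ι 1ℚ)
        ≈⟨ *-cong refl (+-cong refl 1#-homo) ⟩
      P k ∎
      where K = ℕ→ℚ k

    telescope : (Φ w γ : ℕ → ℚ) (A : ℕ → Carrier)
              → (∀ k → Φ k ≡ γ k Q.* w k)
              → (∀ k → Φ (suc k) ≡ w k Q.* (ℕ→ℚ (suc k) Q.* ℕ→ℚ (suc k)))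
              → (∀ k → A k + ι (γ k) ≈ P k)
              → ∀ n → sumR n (λ k → A k * ι (w k) * b k) ≈ ι (Φ n) * b n - ι (Φ 0)
    telescope Φ w γ A Φ≡γw Φ-suc A+γ≈P n = begin
      sumR n (λ k → A k * ι (w k) * b k)
        ≈⟨ sumR-telescope _ (λ k → ι (Φ k) * b k) step n ⟩
      ι (Φ n) * b n - ι (Φ 0) * b 0
        ≈⟨ +-cong refl (-‿cong (trans (*-cong refl b-zero) (*-identityʳ _))) ⟩
      ι (Φ n) * b n - ι (Φ 0) ∎
      where
      step : ∀ k → ι (Φ (suc k)) * b (suc k) ≈ ι (Φ k) * b k + A k * ι (w k) * b k
      step k = begin
        ι (Φ (suc k)) * b (suc k)
          ≈⟨ *-cong (trans (⟦⟧-cong (Φ-suc k)) (*-homo _ _)) refl ⟩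
        ι (w k) * ι (S Q.* S) * b (suc k)
          ≈⟨ trans (*-assoc _ _ _) (*-cong refl (*-comm _ _)) ⟩
        ι (w k) * (b (suc k) * ι (S Q.* S))
          ≈⟨ *-cong refl (trans (b-suc k) (*-cong refl (sym (A+γ≈P k)))) ⟩
        ι (w k) * (b k * (A k + ι (γ k)))
          ≈⟨ solve 4 (λ w c a g → w :* (c :* (a :+ g)) := g :* w :* c :+ a :* w :* c)
                     refl (ι (w k)) (b k) (A k) (ι (γ k)) ⟩
        ι (γ k) * ι (w k) * b k + A k * ι (w k) * b k
          ≈⟨ +-cong (*-cong (sym (trans (⟦⟧-cong (Φ≡γw k)) (*-homo _ _))) refl) refl ⟩
        ι (Φ k) * b k + A k * ι (w k) * b k ∎
        where S = ℕ→ℚ (suc k)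

lemma2p1 : ∀ {c ℓ : Level} (R : CommutativeRing c ℓ)
             (ι : ℚ → CommutativeRing.Carrier R)
           → IsRingHomomorphism QP.+-*-rawRing (CommutativeRing.rawRing R) ι
           → (d : ℚ) (d≢0 : d ≢ 0ℚ) (x : CommutativeRing.Carrier R) (n : ℕ)
           → let open CommutativeRing R
                 open QAlg R ι
                 D = dpow⁻ d d≢0
                 kq = ℕ→ℚ
                 bb = λ (k : ℕ) → binom x k * binom (x + ι (kq k)) k
                 invC = λ (k : ℕ) → invℕ ((2 N.* k) C k)
                 a = λ (e : ℚ) (k : ℕ) → x * x + x + ι e
                       - ι ((Q.1ℚ Q.+ kq 4 Q.* d) Q.* kq k Q.* kq k)
                 a₁ = λ (k : ℕ) → a 0ℚ k - ι ((Q.1ℚ Q.- kq 2 Q.* d) Q.* kq k)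
                 a₂ = λ (k : ℕ) → a 0ℚ k - ι ((Q.1ℚ Q.+ kq 2 Q.* d) Q.* kq k)
                 a₃ = λ (k : ℕ) → a (kq 2 Q.* d) k - ι ((Q.1ℚ Q.+ kq 2 Q.* d) Q.* kq k)
                 m = 2 N.* n
             in (sumR n (λ k → a₁ k * ι (D k Q.* invC k) * bb k)
                   ≈ ι (kq m Q.* (kq m Q.- Q.1ℚ) Q.* d Q.* D n Q.* invC n) * bb n)
              × (sumR n (λ k → a₂ k * ι (D k Q.* invC k Q.* invℕ (suc (2 N.* k)))
                                  * bb k)
                   ≈ ι (kq m Q.* d Q.* D n Q.* invC n) * bb n)
              × (sumR n (λ k → a₃ k * ι (D k Q.* invC k Q.* invℕ (suc k)) * bb k)
                   ≈ ι (kq 2 Q.* d)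
                     + ι (kq 2 Q.* (kq m Q.- Q.1ℚ) Q.* d Q.* D n Q.* invC n) * bb n)
lemma2p1 R ι ι-hom d d≢0 x n =
    (begin
      _                              ≈⟨ telescope x Φ₁ weight γ₁ _ Φ₁≡γ₁*weight Φ₁-suc (P-decomposition x γ₁-splits) n ⟩
      ι (Φ₁ n) * b x n - ι (Φ₁ 0)    ≈⟨ ι-cancel-zero _ Φ₁-zero ⟩
      ι (Φ₁ n) * b x n               ∎)
  , (begin
      _                              ≈⟨ telescope x Φ₂ _ γ₂ _ Φ₂≡γ₂*weight Φ₂-suc (P-decomposition x γ₂-splits) n ⟩
      ι (Φ₂ n) * b x n - ι (Φ₂ 0)    ≈⟨ ι-cancel-zero _ Φ₂-zero ⟩
      ι (Φ₂ n) * b x n               ∎)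
  , (begin
      _                              ≈⟨ telescope x Φ₃ _ γ₃ _ Φ₃≡γ₃*weight Φ₃-suc (P-decomposition x γ₃-splits) n ⟩
      ι (Φ₃ n) * b x n - ι (Φ₃ 0)    ≈⟨ ι-cancel-neg _ Φ₃-zero ⟩
      ι (two Q.* d) + ι (Φ₃ n) * b x n ∎)
  where
  open CommutativeRing R
  open ℚ-Algebra R ι ι-hom
  open Certificates d d≢0
  open import Relation.Binary.Reasoning.Setoid setoid
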